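{- Let $m\ge 1$, $q=2^m$, $K=GF(q)$, let $i,t,s$ be positive integers and let $\delta\in K$ be nonzero. Define $$F(x,y)=x^{2^i-1}+y^{2^i-1}+\delta (xy)^{2^s-1}\left(x^{2^t-1}+y^{2^t-1}\right)^{2^s}\in K[x,y].$$ Let $d=\gcd(i,t)$. Then $x^{2^d-1}+y^{2^d-1}$ divides $F(x,y)$ in $K[x,y]$.
   Context: $F(x,y)$ equals $\Delta_f(x,y)/(xy)$, where $f(x)=x^{2^i+1}+\delta x^{2^s(2^t+1)}$ and $\Delta_f(x,y)=f(x+y)+f(x)+f(y)$. -}

module Defs where

open import Level using (_⊔_)
open import Algebra.Bundles using (CommutativeRing)
open import Data.Nat using (ℕ; zero; suc; _≟_; _∸_; _^_) renaming (_+_ to _+ℕ_)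
open import Data.Fin using (Fin)
open import Data.List using (List; []; _∷_; _++_; map; concatMap)
open import Data.Product using (Σ; ∃; _×_; _,_)
open import Relation.Nullary using (¬_; yes; no)
open import Relation.Binary.PropositionalEquality using (_≡_)

-- Bivariate polynomials K[x,y] over a commutative ring K, represented as
-- formal finite sums of monomials c·x^a·y^b.  Two polynomials are equal iff
-- all their coefficients agree (w.r.t. the ring's equality).
module Poly2 {c ℓ} (R : CommutativeRing c ℓ) where
  open CommutativeRing R

  record Term : Set c where
    constructor term
    field
      coef : Carrier
      ex   : ℕ
      ey   : ℕ
  open Term

  Poly : Set c
  Poly = List Term

  coeff : Poly → ℕ → ℕ → Carrier
  coeff [] a b = 0#
  coeff (t ∷ p) a b with ex t ≟ a | ey t ≟ b
  ... | yes _ | yes _ = coef t + coeff p a b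
  ... | _     | _     = coeff p a b

  infix 4 _≈P_
  _≈P_ : Poly → Poly → Set ℓ
  p ≈P q = ∀ a b → coeff p a b ≈ coeff q a b

  infixl 6 _+P_
  _+P_ : Poly → Poly → Poly
  p +P q = p ++ q

  mulT : Term → Term → Term
  mulT (term c₁ a₁ b₁) (term c₂ a₂ b₂) = term (c₁ * c₂) (a₁ +ℕ a₂) (b₁ +ℕ b₂)

  infixl 7 _*P_
  _*P_ : Poly → Poly → Poly
  p *P q = concatMap (λ s → map (mulT s) q) p

  oneP : Poly
  oneP = term 1# 0 0 ∷ []

  infixr 8 _^P_
  _^P_ : Poly → ℕ → Poly
  p ^P zero = oneP
  p ^P suc n = p *P (p ^P n)

  constP : Carrier → Poly
  constP k = term k 0 0 ∷ []

  X Y : Poly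
  X = term 1# 1 0 ∷ []
  Y = term 1# 0 1 ∷ []

  infix 4 _∣P_
  _∣P_ : Poly → Poly → Set (c ⊔ ℓ)
  p ∣P q = Σ Poly λ r → p *P r ≈P q

  F : Carrier → ℕ → ℕ → ℕ → Poly
  F δ i t s =
    X ^P (2 ^ i ∸ 1) +P Y ^P (2 ^ i ∸ 1)
    +P constP δ *P (X *P Y) ^P (2 ^ s ∸ 1)
         *P (X ^P (2 ^ t ∸ 1) +P Y ^P (2 ^ t ∸ 1)) ^P (2 ^ s)

-- K is (a model of) the finite field GF(2^m): a commutative ring with 0 ≠ 1,
-- every nonzero element invertible, characteristic 2, and exactly 2^m
-- elements (a bijection, up to the ring's equality, with Fin (2^m)).
record IsGF {c ℓ} (K : CommutativeRing c ℓ) (m : ℕ) : Set (c ⊔ ℓ) where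
  open CommutativeRing K
  field
    0≉1      : ¬ (0# ≈ 1#)
    inverse  : ∀ x → ¬ (x ≈ 0#) → ∃ λ y → x * y ≈ 1#
    char2    : 1# + 1# ≈ 0#
    enum     : Fin (2 ^ m) → Carrier
    enum-inj : ∀ a b → enum a ≈ enum b → a ≡ b
    enum-sur : ∀ x → ∃ λ a → enum a ≈ x

{-# OPTIONS --safe #-}
-- In characteristic 2 we have x + y ∣ xᵏ + yᵏ for every k, since −1 = 1 turns the usual
-- factorisation of xᵏ − yᵏ into one of xᵏ + yᵏ.  If d = gcd(i, t) then 2^d − 1 divides both
-- 2^i − 1 and 2^t − 1, so with u = x^(2^d−1) and v = y^(2^d−1) the two sums
-- x^(2^i−1) + y^(2^i−1) and x^(2^t−1) + y^(2^t−1) are of the form uᵏ + vᵏ and hence divisible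
-- by u + v; F is a combination of the first and a positive power of the second.
module Submission where

open import Defs
open import Algebra.Bundles using (CommutativeRing; CommutativeSemiring)
open import Algebra.Structures.Biased using (isCommutativeMonoidˡ; isCommutativeSemiringˡ)
open import Data.Empty using (⊥-elim)
open import Data.List using (List; []; _∷_; _++_; map; concatMap)
open import Data.List.Properties using (++-assoc; concatMap-++)
open import Data.Product using (_,_)
open import Data.Nat using (ℕ; zero; suc; _≤_; _≟_; _≤?_; _∸_; NonZero)
import Data.Nat as ℕ
import Data.Nat.Properties as ℕ
open import Data.Nat.Divisibility using (divides-refl; _∣0; ∣m∣n⇒∣m+n; m∣m*n) renaming (_∣_ to _∣ℕ_)
open import Data.Nat.GCD using (gcd; gcd[m,n]∣m; gcd[m,n]∣n)
open import Relation.Binary.PropositionalEquality as ≡ using (_≡_)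
open import Relation.Binary.Structures using (IsEquivalence)
open import Relation.Nullary using (¬_; yes; no)

m+n≡o⇒m≡o∸n : ∀ {m n o} → m ℕ.+ n ≡ o → m ≡ o ∸ n
m+n≡o⇒m≡o∸n {m} {n} m+n≡o = ≡.trans (≡.sym (ℕ.m+n∸n≡m m n)) (≡.cong (_∸ n) m+n≡o)

m≡o∸n⇒m+n≡o : ∀ {m n o} → n ≤ o → m ≡ o ∸ n → m ℕ.+ n ≡ o
m≡o∸n⇒m+n≡o n≤o m≡o∸n = ≡.trans (≡.cong (ℕ._+ _) m≡o∸n) (ℕ.m∸n+n≡m n≤o)

module CommutativeSemiringProperties {c ℓ} (S : CommutativeSemiring c ℓ) where
  open CommutativeSemiring S
  open import Algebra.Definitions.RawMagma *-rawMagma using (_∣ˡ_; _,_)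
  open import Algebra.Definitions.RawSemiring rawSemiring using (_^_)
  open import Algebra.Properties.Semiring.Divisibility semiring
    using (x∣ˡxy; x∣ˡy⇒x∣ˡyz; ∣ˡ-respʳ-≈)
  open import Algebra.Properties.Semiring.Exp semiring using (^-assocʳ; ^-congʳ)
  open import Relation.Binary.Reasoning.Setoid setoid

  x∣ˡ0 : ∀ x → x ∣ˡ 0#
  x∣ˡ0 x = 0# , zeroʳ x

  x∣ˡy⇒x∣ˡzy : ∀ {x y} z → x ∣ˡ y → x ∣ˡ z * y
  x∣ˡy⇒x∣ˡzy z x∣ˡy = ∣ˡ-respʳ-≈ (*-comm _ z) (x∣ˡy⇒x∣ˡyz z x∣ˡy)

  x∣ˡy∧x∣ˡz⇒x∣ˡy+z : ∀ {x y z} → x ∣ˡ y → x ∣ˡ z → x ∣ˡ y + z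
  x∣ˡy∧x∣ˡz⇒x∣ˡy+z {x} (q , xq≈y) (r , xr≈z) = q + r , trans (distribˡ x q r) (+-cong xq≈y xr≈z)

  x∣ˡy⇒x∣ˡyⁿ : ∀ {x y} n .{{_ : NonZero n}} → x ∣ˡ y → x ∣ˡ y ^ n
  x∣ˡy⇒x∣ˡyⁿ (suc n) = x∣ˡy⇒x∣ˡyz (_ ^ n)

  1+1≈0⇒x+x≈0 : 1# + 1# ≈ 0# → ∀ x → x + x ≈ 0#
  1+1≈0⇒x+x≈0 1+1≈0 x = begin
    x + x             ≈⟨ +-cong (*-identityʳ x) (*-identityʳ x) ⟨
    x * 1# + x * 1#   ≈⟨ distribˡ x 1# 1# ⟨
    x * (1# + 1#)     ≈⟨ *-congˡ 1+1≈0 ⟩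
    x * 0#            ≈⟨ zeroʳ x ⟩
    0#                ∎

  module CharacteristicTwo (x+x≈0 : ∀ x → x + x ≈ 0#) where

    xⁿ⁺¹+yⁿ⁺¹≈[x+y]xⁿ+[xⁿ+yⁿ]y : ∀ x y n →
      x ^ suc n + y ^ suc n ≈ (x + y) * x ^ n + (x ^ n + y ^ n) * y
    xⁿ⁺¹+yⁿ⁺¹≈[x+y]xⁿ+[xⁿ+yⁿ]y x y n = begin
      x * u + y * v                      ≈⟨ +-congʳ (+-identityʳ (x * u)) ⟨
      x * u + 0# + y * v                 ≈⟨ +-congʳ (+-congˡ (x+x≈0 (y * u))) ⟨
      x * u + (y * u + y * u) + y * v    ≈⟨ +-congʳ (+-assoc (x * u) (y * u) (y * u)) ⟨
      x * u + y * u + y * u + y * v      ≈⟨ +-assoc (x * u + y * u) (y * u) (y * v) ⟩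
      x * u + y * u + (y * u + y * v)    ≈⟨ +-cong (distribʳ u x y) (distribˡ y u v) ⟨
      (x + y) * u + y * (u + v)          ≈⟨ +-congˡ (*-comm y (u + v)) ⟩
      (x + y) * u + (u + v) * y          ∎
      where u = x ^ n; v = y ^ n

    x+y∣ˡxⁿ+yⁿ : ∀ x y n → x + y ∣ˡ x ^ n + y ^ n
    x+y∣ˡxⁿ+yⁿ x y zero    = ∣ˡ-respʳ-≈ (sym (x+x≈0 1#)) (x∣ˡ0 (x + y))
    x+y∣ˡxⁿ+yⁿ x y (suc n) = ∣ˡ-respʳ-≈ (sym (xⁿ⁺¹+yⁿ⁺¹≈[x+y]xⁿ+[xⁿ+yⁿ]y x y n))
      (x∣ˡy∧x∣ˡz⇒x∣ˡy+z (x∣ˡxy (x + y) (x ^ n)) (x∣ˡy⇒x∣ˡyz y (x+y∣ˡxⁿ+yⁿ x y n)))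

    xᵈ+yᵈ∣ˡxⁿ+yⁿ : ∀ x y {d n} → d ∣ℕ n → x ^ d + y ^ d ∣ˡ x ^ n + y ^ n
    xᵈ+yᵈ∣ˡxⁿ+yⁿ x y {d} (divides-refl k) =
      ∣ˡ-respʳ-≈ (+-cong (powᵈᵏ x) (powᵈᵏ y)) (x+y∣ˡxⁿ+yⁿ (x ^ d) (y ^ d) k)
      where
      powᵈᵏ : ∀ z → (z ^ d) ^ k ≈ z ^ (k ℕ.* d)
      powᵈᵏ z = trans (^-assocʳ z d k) (^-congʳ z (ℕ.*-comm d k))

    xᵈ+yᵈ∣ˡxⁱ+yⁱ+b[xᵗ+yᵗ]ⁿ : ∀ x y b {d i t} n .{{_ : NonZero n}} → d ∣ℕ i → d ∣ℕ t →
      x ^ d + y ^ d ∣ˡ x ^ i + y ^ i + b * (x ^ t + y ^ t) ^ n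
    xᵈ+yᵈ∣ˡxⁱ+yⁱ+b[xᵗ+yᵗ]ⁿ x y b n d∣i d∣t = x∣ˡy∧x∣ˡz⇒x∣ˡy+z (xᵈ+yᵈ∣ˡxⁿ+yⁿ x y d∣i)
      (x∣ˡy⇒x∣ˡzy b (x∣ˡy⇒x∣ˡyⁿ n (xᵈ+yᵈ∣ˡxⁿ+yⁿ x y d∣t)))

module Poly2Semiring {c ℓ} (R : CommutativeRing c ℓ) where
  open CommutativeRing R
  open Poly2 R
  open Term
  open import Algebra.Properties.CommutativeSemigroup +-commutativeSemigroup using (interchange)
  open import Relation.Binary.Reasoning.Setoid setoid

  ∑ : ∀ {a} {A : Set a} → List A → (A → Carrier) → Carrier
  ∑ []       f = 0#
  ∑ (x ∷ xs) f = f x + ∑ xs f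

  module _ {a} {A : Set a} where

    ∑-cong : ∀ (xs : List A) {f g} → (∀ x → f x ≈ g x) → ∑ xs f ≈ ∑ xs g
    ∑-cong []       f≈g = refl
    ∑-cong (x ∷ xs) f≈g = +-cong (f≈g x) (∑-cong xs f≈g)

    ∑-++ : ∀ (xs ys : List A) f → ∑ (xs ++ ys) f ≈ ∑ xs f + ∑ ys f
    ∑-++ []       ys f = sym (+-identityˡ _)
    ∑-++ (x ∷ xs) ys f = trans (+-congˡ (∑-++ xs ys f)) (sym (+-assoc _ _ _))

    ∑-0 : ∀ (xs : List A) → ∑ xs (λ _ → 0#) ≈ 0#
    ∑-0 []       = refl
    ∑-0 (x ∷ xs) = trans (+-identityˡ _) (∑-0 xs)

    ∑-+ : ∀ (xs : List A) f g → ∑ xs (λ x → f x + g x) ≈ ∑ xs f + ∑ xs g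
    ∑-+ []       f g = sym (+-identityˡ _)
    ∑-+ (x ∷ xs) f g = trans (+-congˡ (∑-+ xs f g)) (interchange _ _ _ _)

    ∑-*ʳ : ∀ (xs : List A) f k → ∑ xs (λ x → f x * k) ≈ ∑ xs f * k
    ∑-*ʳ []       f k = sym (zeroˡ k)
    ∑-*ʳ (x ∷ xs) f k = trans (+-congˡ (∑-*ʳ xs f k)) (sym (distribʳ k _ _))

  ∑-map : ∀ {a b} {A : Set a} {B : Set b} (h : A → B) (xs : List A) f →
    ∑ (map h xs) f ≡ ∑ xs (λ x → f (h x))
  ∑-map h []       f = ≡.refl
  ∑-map h (x ∷ xs) f = ≡.cong (f (h x) +_) (∑-map h xs f)

  ∑-concatMap : ∀ {a b} {A : Set a} {B : Set b} (h : A → List B) (xs : List A) f →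
    ∑ (concatMap h xs) f ≈ ∑ xs (λ x → ∑ (h x) f)
  ∑-concatMap h []       f = refl
  ∑-concatMap h (x ∷ xs) f = trans (∑-++ (h x) (concatMap h xs) f) (+-congˡ (∑-concatMap h xs f))

  ∑-swap : ∀ {a b} {A : Set a} {B : Set b} (xs : List A) (ys : List B) (g : A → B → Carrier) →
    ∑ xs (λ x → ∑ ys (g x)) ≈ ∑ ys (λ y → ∑ xs (λ x → g x y))
  ∑-swap []       ys g = sym (∑-0 ys)
  ∑-swap (x ∷ xs) ys g =
    trans (+-congˡ (∑-swap xs ys g)) (sym (∑-+ ys (g x) (λ y → ∑ xs (λ x → g x y))))

  coeffᵀ : Term → ℕ → ℕ → Carrier
  coeffᵀ t a b with ex t ≟ a | ey t ≟ b
  ... | yes _ | yes _ = coef t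
  ... | _     | _     = 0#

  coeffᵀ-cong : ∀ {k k' e e' f f'} a b → k ≈ k' → e ≡ e' → f ≡ f' →
    coeffᵀ (term k e f) a b ≈ coeffᵀ (term k' e' f') a b
  coeffᵀ-cong {e = e} {f = f} a b k≈k' ≡.refl ≡.refl with e ≟ a | f ≟ b
  ... | yes _ | yes _ = k≈k'
  ... | yes _ | no _  = refl
  ... | no _  | _     = refl

  coeff≈∑coeffᵀ : ∀ p a b → coeff p a b ≈ ∑ p (λ t → coeffᵀ t a b)
  coeff≈∑coeffᵀ []      a b = refl
  coeff≈∑coeffᵀ (t ∷ p) a b with ex t ≟ a | ey t ≟ b
  ... | yes _ | yes _ = +-congˡ (coeff≈∑coeffᵀ p a b)
  ... | yes _ | no _  = trans (coeff≈∑coeffᵀ p a b) (sym (+-identityˡ _))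
  ... | no _  | _     = trans (coeff≈∑coeffᵀ p a b) (sym (+-identityˡ _))

  -- The coefficient of x^a y^b in g · u, where φ gives the coefficients of g.
  shift : Term → (ℕ → ℕ → Carrier) → ℕ → ℕ → Carrier
  shift u φ a b with ex u ≤? a | ey u ≤? b
  ... | yes _ | yes _ = φ (a ∸ ex u) (b ∸ ey u) * coef u
  ... | _     | _     = 0#

  shift-cong : ∀ u {φ ψ} → (∀ a b → φ a b ≈ ψ a b) → ∀ a b → shift u φ a b ≈ shift u ψ a b
  shift-cong u φ≈ψ a b with ex u ≤? a | ey u ≤? b
  ... | yes _ | yes _ = *-congʳ (φ≈ψ _ _)
  ... | yes _ | no _  = refl
  ... | no _  | _     = refl

  ∑-shift : ∀ (p : Poly) u (φ : Term → ℕ → ℕ → Carrier) a b →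
    ∑ p (λ s → shift u (φ s) a b) ≈ shift u (λ a b → ∑ p (λ s → φ s a b)) a b
  ∑-shift p u φ a b with ex u ≤? a | ey u ≤? b
  ... | yes _ | yes _ = ∑-*ʳ p _ (coef u)
  ... | yes _ | no _  = ∑-0 p
  ... | no _  | _     = ∑-0 p

  coeffᵀ-mulT : ∀ s u a b → coeffᵀ (mulT s u) a b ≈ shift u (coeffᵀ s) a b
  coeffᵀ-mulT (term ks es fs) (term ku eu fu) a b with eu ≤? a | fu ≤? b
  ... | no eu≰a | _ with es ℕ.+ eu ≟ a
  ...   | yes e = ⊥-elim (eu≰a (≡.subst (eu ≤_) e (ℕ.m≤n+m eu es)))
  ...   | no _  = refl
  coeffᵀ-mulT (term ks es fs) (term ku eu fu) a b | yes _ | no fu≰b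
    with es ℕ.+ eu ≟ a | fs ℕ.+ fu ≟ b
  ...   | _     | yes e = ⊥-elim (fu≰b (≡.subst (fu ≤_) e (ℕ.m≤n+m fu fs)))
  ...   | yes _ | no _  = refl
  ...   | no _  | no _  = refl
  coeffᵀ-mulT (term ks es fs) (term ku eu fu) a b | yes eu≤a | yes fu≤b
    with es ℕ.+ eu ≟ a | es ≟ a ∸ eu | fs ℕ.+ fu ≟ b | fs ≟ b ∸ fu
  ... | yes _ | yes _ | yes _ | yes _ = refl
  ... | yes _ | yes _ | no _  | no _  = sym (zeroˡ ku)
  ... | no _  | no _  | _     | _     = sym (zeroˡ ku)
  ... | yes e | no ¬e | _     | _     = ⊥-elim (¬e (m+n≡o⇒m≡o∸n e))
  ... | no ¬e | yes e | _     | _     = ⊥-elim (¬e (m≡o∸n⇒m+n≡o eu≤a e))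
  ... | yes _ | yes _ | yes e | no ¬e = ⊥-elim (¬e (m+n≡o⇒m≡o∸n e))
  ... | yes _ | yes _ | no ¬e | yes e = ⊥-elim (¬e (m≡o∸n⇒m+n≡o fu≤b e))

  coeff-+P : ∀ p q a b → coeff (p +P q) a b ≈ coeff p a b + coeff q a b
  coeff-+P p q a b = begin
    coeff (p ++ q) a b                                       ≈⟨ coeff≈∑coeffᵀ (p ++ q) a b ⟩
    ∑ (p ++ q) (λ t → coeffᵀ t a b)                          ≈⟨ ∑-++ p q _ ⟩
    ∑ p (λ t → coeffᵀ t a b) + ∑ q (λ t → coeffᵀ t a b)      ≈⟨ +-cong (coeff≈∑coeffᵀ p a b) (coeff≈∑coeffᵀ q a b) ⟨
    coeff p a b + coeff q a b                                ∎

  ∑-*P : ∀ p q g → ∑ (p *P q) g ≈ ∑ p (λ s → ∑ q (λ u → g (mulT s u)))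
  ∑-*P p q g = trans (∑-concatMap (λ s → map (mulT s) q) p g)
    (∑-cong p (λ s → reflexive (∑-map (mulT s) q g)))

  coeff-*P : ∀ p q a b → coeff (p *P q) a b ≈ ∑ p (λ s → ∑ q (λ u → coeffᵀ (mulT s u) a b))
  coeff-*P p q a b = trans (coeff≈∑coeffᵀ (p *P q) a b) (∑-*P p q _)

  coeff-*P-shift : ∀ p q a b → coeff (p *P q) a b ≈ ∑ q (λ u → shift u (coeff p) a b)
  coeff-*P-shift p q a b = begin
    coeff (p *P q) a b                                          ≈⟨ coeff-*P p q a b ⟩
    ∑ p (λ s → ∑ q (λ u → coeffᵀ (mulT s u) a b))               ≈⟨ ∑-swap p q _ ⟩
    ∑ q (λ u → ∑ p (λ s → coeffᵀ (mulT s u) a b))               ≈⟨ ∑-cong q (λ u → ∑-cong p (λ s → coeffᵀ-mulT s u a b)) ⟩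
    ∑ q (λ u → ∑ p (λ s → shift u (coeffᵀ s) a b))              ≈⟨ ∑-cong q (λ u → ∑-shift p u coeffᵀ a b) ⟩
    ∑ q (λ u → shift u (λ a b → ∑ p (λ s → coeffᵀ s a b)) a b)  ≈⟨ ∑-cong q (λ u → shift-cong u (λ a b → coeff≈∑coeffᵀ p a b) a b) ⟨
    ∑ q (λ u → shift u (coeff p) a b)                           ∎

  ≡⇒≈P : ∀ {p q} → p ≡ q → p ≈P q
  ≡⇒≈P ≡.refl a b = refl

  ≈P-isEquivalence : IsEquivalence _≈P_
  ≈P-isEquivalence = record
    { refl  = λ a b → refl
    ; sym   = λ p≈q a b → sym (p≈q a b)
    ; trans = λ p≈q q≈r a b → trans (p≈q a b) (q≈r a b)
    }

  +P-cong : ∀ {p p' q q'} → p ≈P p' → q ≈P q' → p +P q ≈P p' +P q'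
  +P-cong {p} {p'} {q} {q'} p≈p' q≈q' a b =
    trans (coeff-+P p q a b) (trans (+-cong (p≈p' a b) (q≈q' a b)) (sym (coeff-+P p' q' a b)))

  +P-comm : ∀ p q → p +P q ≈P q +P p
  +P-comm p q a b = trans (coeff-+P p q a b) (trans (+-comm _ _) (sym (coeff-+P q p a b)))

  *P-congˡ : ∀ {p p'} q → p ≈P p' → p *P q ≈P p' *P q
  *P-congˡ {p} {p'} q p≈p' a b = trans (coeff-*P-shift p q a b)
    (trans (∑-cong q (λ u → shift-cong u p≈p' a b)) (sym (coeff-*P-shift p' q a b)))

  *P-comm : ∀ p q → p *P q ≈P q *P p
  *P-comm p q a b = begin
    coeff (p *P q) a b                               ≈⟨ coeff-*P p q a b ⟩
    ∑ p (λ s → ∑ q (λ u → coeffᵀ (mulT s u) a b))    ≈⟨ ∑-swap p q _ ⟩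
    ∑ q (λ u → ∑ p (λ s → coeffᵀ (mulT s u) a b))    ≈⟨ ∑-cong q (λ u → ∑-cong p (λ s → mulT-comm s u)) ⟩
    ∑ q (λ u → ∑ p (λ s → coeffᵀ (mulT u s) a b))    ≈⟨ coeff-*P q p a b ⟨
    coeff (q *P p) a b                               ∎
    where
    mulT-comm : ∀ s u → coeffᵀ (mulT s u) a b ≈ coeffᵀ (mulT u s) a b
    mulT-comm s u = coeffᵀ-cong a b (*-comm (coef s) (coef u))
      (ℕ.+-comm (ex s) (ex u)) (ℕ.+-comm (ey s) (ey u))

  *P-assoc : ∀ p q r → (p *P q) *P r ≈P p *P (q *P r)
  *P-assoc p q r a b = begin
    coeff ((p *P q) *P r) a b                                           ≈⟨ coeff-*P (p *P q) r a b ⟩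
    ∑ (p *P q) (λ v → ∑ r (λ w → coeffᵀ (mulT v w) a b))                ≈⟨ ∑-*P p q _ ⟩
    ∑ p (λ s → ∑ q (λ u → ∑ r (λ w → coeffᵀ (mulT (mulT s u) w) a b)))  ≈⟨ ∑-cong p (λ s → ∑-cong q (λ u → ∑-cong r (mulT-assoc s u))) ⟩
    ∑ p (λ s → ∑ q (λ u → ∑ r (λ w → coeffᵀ (mulT s (mulT u w)) a b)))  ≈⟨ ∑-cong p (λ s → ∑-*P q r _) ⟨
    ∑ p (λ s → ∑ (q *P r) (λ v → coeffᵀ (mulT s v) a b))                ≈⟨ coeff-*P p (q *P r) a b ⟨
    coeff (p *P (q *P r)) a b                                           ∎
    where
    mulT-assoc : ∀ s u w → coeffᵀ (mulT (mulT s u) w) a b ≈ coeffᵀ (mulT s (mulT u w)) a b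
    mulT-assoc s u w = coeffᵀ-cong a b (*-assoc _ _ _) (ℕ.+-assoc (ex s) _ _) (ℕ.+-assoc (ey s) _ _)

  *P-identityˡ : ∀ p → oneP *P p ≈P p
  *P-identityˡ p a b = begin
    coeff (oneP *P p) a b                                  ≈⟨ coeff-*P oneP p a b ⟩
    ∑ p (λ u → coeffᵀ (mulT (term 1# 0 0) u) a b) + 0#     ≈⟨ +-identityʳ _ ⟩
    ∑ p (λ u → coeffᵀ (mulT (term 1# 0 0) u) a b)          ≈⟨ ∑-cong p (λ u → coeffᵀ-cong a b (*-identityˡ (coef u)) (≡.refl {x = ex u}) (≡.refl {x = ey u})) ⟩
    ∑ p (λ u → coeffᵀ u a b)                               ≈⟨ coeff≈∑coeffᵀ p a b ⟨
    coeff p a b                                            ∎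

  +P-*P-commutativeSemiring : CommutativeSemiring c ℓ
  +P-*P-commutativeSemiring = record
    { Carrier = Poly
    ; _≈_ = _≈P_
    ; _+_ = _+P_
    ; _*_ = _*P_
    ; 0# = []
    ; 1# = oneP
    ; isCommutativeSemiring = isCommutativeSemiringˡ record
      { +-isCommutativeMonoid = isCommutativeMonoidˡ record
        { isSemigroup = record
          { isMagma = record
            { isEquivalence = ≈P-isEquivalence
            ; ∙-cong = λ {p} {p'} {q} {q'} → +P-cong {p} {p'} {q} {q'}
            }
          ; assoc = λ p q r → ≡⇒≈P (++-assoc p q r)
          }
        ; identityˡ = λ p a b → refl
        ; comm = +P-comm
        }
      ; *-isCommutativeMonoid = isCommutativeMonoidˡ record
        { isSemigroup = record
          { isMagma = record
            { isEquivalence = ≈P-isEquivalence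
            ; ∙-cong = λ {p} {p'} {q} {q'} → *P-cong {p} {p'} {q} {q'}
            }
          ; assoc = *P-assoc
          }
        ; identityˡ = *P-identityˡ
        ; comm = *P-comm
        }
      ; distribʳ = λ r p q → ≡⇒≈P (concatMap-++ (λ s → map (mulT s) r) p q)
      ; zeroˡ = λ p a b → refl
      }
    }
    where
    *P-cong : ∀ {p p' q q'} → p ≈P p' → q ≈P q' → p *P q ≈P p' *P q'
    *P-cong {p} {p'} {q} {q'} p≈p' q≈q' a b = trans (*P-congˡ {p} {p'} q p≈p' a b)
      (trans (*P-comm p' q a b) (trans (*P-congˡ {q} {q'} p' q≈q' a b) (*P-comm q' p' a b)))

  +P-self≈0 : (∀ x → x + x ≈ 0#) → ∀ p → p +P p ≈P []
  +P-self≈0 x+x≈0 p a b = trans (coeff-+P p p a b) (x+x≈0 (coeff p a b))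

  open import Algebra.Definitions.RawSemiring (CommutativeSemiring.rawSemiring +P-*P-commutativeSemiring)
    using (_^_)

  ^≡^P : ∀ p n → p ^ n ≡ p ^P n
  ^≡^P p zero    = ≡.refl
  ^≡^P p (suc n) = ≡.cong (p *P_) (^≡^P p n)

  xᵈ+yᵈ∣Pxⁱ+yⁱ+b[xᵗ+yᵗ]ⁿ : (∀ x → x + x ≈ 0#) → ∀ x y b {d i t} n .{{_ : NonZero n}} →
    d ∣ℕ i → d ∣ℕ t → x ^P d +P y ^P d ∣P x ^P i +P y ^P i +P b *P (x ^P t +P y ^P t) ^P n
  xᵈ+yᵈ∣Pxⁱ+yⁱ+b[xᵗ+yᵗ]ⁿ x+x≈0 x y b {d} {i} {t} n d∣i d∣t = ∣ˡ⇒∣P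
    (≡.subst₂ _∣ˡ_ (xⁿ+yⁿ≡ d)
      (≡.cong₂ _+P_ (xⁿ+yⁿ≡ i) (≡.cong (b *P_) (≡.trans (^≡^P _ n) (≡.cong (_^P n) (xⁿ+yⁿ≡ t)))))
      (xᵈ+yᵈ∣ˡxⁱ+yⁱ+b[xᵗ+yᵗ]ⁿ x y b n d∣i d∣t))
    where
    open import Algebra.Definitions.RawMagma (CommutativeSemiring.*-rawMagma +P-*P-commutativeSemiring)
      using (_∣ˡ_; _,_)
    open CommutativeSemiringProperties.CharacteristicTwo +P-*P-commutativeSemiring (+P-self≈0 x+x≈0)

    xⁿ+yⁿ≡ : ∀ n → x ^ n +P y ^ n ≡ x ^P n +P y ^P n
    xⁿ+yⁿ≡ n = ≡.cong₂ _+P_ (^≡^P x n) (^≡^P y n)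

    ∣ˡ⇒∣P : ∀ {p q} → p ∣ˡ q → p ∣P q
    ∣ˡ⇒∣P (r , pr≈q) = r , pr≈q

open import Data.Nat using (_^_)

m∸1∣m^n∸1 : ∀ m n → m ∸ 1 ∣ℕ m ^ n ∸ 1
m∸1∣m^n∸1 _       zero    = _ ∣0
m∸1∣m^n∸1 zero    (suc n) = 0 ∣0
m∸1∣m^n∸1 (suc w) (suc n) =
  ≡.subst (w ∣ℕ_) (≡.sym (ℕ.+-∸-comm (w ℕ.* p) (ℕ.m^n>0 (suc w) n)))
    (∣m∣n⇒∣m+n (m∸1∣m^n∸1 (suc w) n) (m∣m*n p))
  where p = suc w ^ n

m^d∸1∣m^n∸1 : ∀ m {d n} → d ∣ℕ n → m ^ d ∸ 1 ∣ℕ m ^ n ∸ 1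
m^d∸1∣m^n∸1 m {d} (divides-refl q) =
  ≡.subst (λ e → m ^ d ∸ 1 ∣ℕ e ∸ 1) (≡.trans (ℕ.^-*-assoc m d q) (≡.cong (m ^_) (ℕ.*-comm d q)))
    (m∸1∣m^n∸1 (m ^ d) q)

lemma1 : ∀ {c ℓ} (K : CommutativeRing c ℓ) (m : ℕ) → 1 ≤ m → IsGF K m →
    (i t s : ℕ) → 1 ≤ i → 1 ≤ t → 1 ≤ s →
    (δ : CommutativeRing.Carrier K) → ¬ (CommutativeRing._≈_ K δ (CommutativeRing.0# K)) →
    let open Poly2 K in
    (X ^P (2 ^ gcd i t ∸ 1) +P Y ^P (2 ^ gcd i t ∸ 1)) ∣P F δ i t s
lemma1 K _ _ K-is-GF i t s _ _ _ δ _ =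
  xᵈ+yᵈ∣Pxⁱ+yⁱ+b[xᵗ+yᵗ]ⁿ (1+1≈0⇒x+x≈0 (IsGF.char2 K-is-GF)) X Y
    (constP δ *P (X *P Y) ^P (2 ^ s ∸ 1)) (2 ^ s) {{ℕ.m^n≢0 2 s}}
    (m^d∸1∣m^n∸1 2 (gcd[m,n]∣m i t)) (m^d∸1∣m^n∸1 2 (gcd[m,n]∣n i t))
  where
  open Poly2 K
  open Poly2Semiring K
  open CommutativeSemiringProperties (CommutativeRing.commutativeSemiring K) using (1+1≈0⇒x+x≈0)
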